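{- Let $G=(V,E)$ be an unweighted undirected graph on $n$ nodes and let $D\ge 2$ be an integer. Let $R$ be a random multiset of $\lceil 2\cdot\frac{n}{D}\ln D\rceil$ elements, each chosen independently and uniformly at random from $V$. For a node $u$, call a node $v$ uncovered for $u$ if $dist_G(u,v)\ge D$ and no element of $R$ lies on a shortest path between $u$ and $v$; call $u$ sick if it has more than $\frac{n}{D}$ uncovered nodes, and let $S$ be the set of sick nodes. Then $\Pr\left[|S|\ge 2\frac{n}{D}\right]\le \frac12$.
   Context: $dist_G(u,v)$ denotes the shortest-path distance (number of edges) in $G$; a node lying on a shortest path includes its endpoints. -}

module Defs where

open import Level using (0ℓ)
open import Data.Nat using (ℕ; zero; suc; _+_; _*_; _^_; _≤_; _<_)
open import Data.Fin using (Fin)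
open import Data.Vec using (Vec; lookup)
open import Data.Product using (Σ; ∃; _×_; _,_)
open import Data.List using (List; length)
open import Data.List.Relation.Unary.All using (All)
open import Data.List.Relation.Unary.Unique.Propositional using (Unique)
open import Relation.Nullary using (¬_)

record Graph (n : ℕ) : Set₁ where
  field
    Adj     : Fin n → Fin n → Set
    sym     : ∀ {u v} → Adj u v → Adj v u
    irrefl  : ∀ {u} → ¬ Adj u u

module _ {n : ℕ} (G : Graph n) where
  open Graph G

  data Walk : Fin n → Fin n → ℕ → Set where
    here : ∀ {u} → Walk u u 0
    step : ∀ {u w v ℓ} → Adj u w → Walk w v ℓ → Walk u v (suc ℓ)

  data OnWalk (x : Fin n) : ∀ {u v ℓ} → Walk u v ℓ → Set where
    on-here  : OnWalk x (here {x})
    on-start : ∀ {w v ℓ} (a : Adj x w) (p : Walk w v ℓ) → OnWalk x (step a p)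
    on-later : ∀ {u w v ℓ} (a : Adj u w) {p : Walk w v ℓ} → OnWalk x p → OnWalk x (step a p)

  -- dist_G(u,v) = d  (only defined when v is reachable from u)
  IsDist : Fin n → Fin n → ℕ → Set
  IsDist u v d = Walk u v d × (∀ ℓ → Walk u v ℓ → d ≤ ℓ)

  OnShortestPath : Fin n → Fin n → Fin n → Set
  OnShortestPath x u v = Σ ℕ λ d → IsDist u v d × Σ (Walk u v d) λ p → OnWalk x p

  Uncovered : ∀ {k} → ℕ → (Vec (Fin n) k) → Fin n → Fin n → Set
  Uncovered {k} D R u v =
    (Σ ℕ λ d → IsDist u v d × D ≤ d) × (∀ (i : Fin k) → ¬ OnShortestPath (lookup R i) u v)

  -- u is sick: more than n/D uncovered nodes, i.e. there are m distinct
  -- uncovered nodes with m > n/D (⇔ m * D > n).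
  Sick : ∀ {k} → ℕ → (Vec (Fin n) k) → Fin n → Set
  Sick D R u = Σ (List (Fin n)) λ vs →
    Unique vs × All (Uncovered D R u) vs × n < length vs * D

  -- |S| ≥ 2 n / D  (⇔ |S| * D ≥ 2 n), witnessed by a list of distinct sick nodes.
  ManySick : ∀ {k} → ℕ → (Vec (Fin n) k) → Set
  ManySick D R = Σ (List (Fin n)) λ us →
    Unique us × All (Sick D R) us × 2 * n ≤ length us * D

-- Encoding of the real number  ⌈ 2 (n/D) ln D ⌉  without reals.
--
-- expPartialScaled m j = j! * Σ_{i=0}^{j} m^i / i!   (a natural number),
-- via the recurrence T 0 = 1, T (j+1) = (j+1) * T j + m^(j+1).

expPartialScaled : ℕ → ℕ → ℕ
expPartialScaled m zero    = 1
expPartialScaled m (suc j) = suc j * expPartialScaled m j + m ^ suc j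

factorial : ℕ → ℕ
factorial zero    = 1
factorial (suc j) = suc j * factorial j

-- ExpGe m N  ⇔  e^m ≥ N   (for naturals m, N): some partial sum of the
-- exponential series Σ m^i/i! reaches N.  (e^m is irrational for m ≥ 1 and
-- equals 1 for m = 0, so this is exactly e^m ≥ N.)
ExpGe : ℕ → ℕ → Set
ExpGe m N = Σ ℕ λ j → N * factorial j ≤ expPartialScaled m j

-- k ≥ 2 (n/D) ln D   ⇔   k D ≥ 2 n ln D   ⇔   e^(k D) ≥ D^(2 n)   (D ≥ 2)
AtLeastBound : ℕ → ℕ → ℕ → Set
AtLeastBound n D k = ExpGe (k * D) (D ^ (2 * n))

-- k = ⌈ 2 (n/D) ln D ⌉ : the least natural number ≥ 2 (n/D) ln D.
IsSampleSize : ℕ → ℕ → ℕ → Set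
IsSampleSize n D k = AtLeastBound n D k × (∀ k′ → AtLeastBound n D k′ → k ≤ k′)

-- Probability over R uniform in (Vec (Fin n) k) (k i.i.d. uniform nodes):
-- Pr[E] ≤ 1/2  ⇔  every finite set of outcomes in E has size ≤ n^k / 2.

ProbAtMostHalf : (n k : ℕ) → ((Vec (Fin n) k) → Set) → Set
ProbAtMostHalf n k E =
  ∀ (Rs : List (Vec (Fin n) k)) → Unique Rs → All E Rs → 2 * length Rs ≤ n ^ k

module Submission where

-- Double count the triples (R, u, v) in which v is uncovered for u under the sample R. A sample
-- with at least 2n/D sick nodes, each having more than n/D uncovered nodes, contributes at least
-- 2n²/D² triples. Conversely, if v is uncovered for u then every entry of R avoids one fixed
-- shortest u–v path, which has at least D + 1 nodes; so each pair (u, v) lies in at most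
-- (n − D)^k triples. Hence the number of bad samples is at most D²(n − D)^k / 2, and the choice
-- of k makes D²(1 − D/n)^k ≤ D² e^(−kD/n) ≤ 1. The last step is carried out with truncated
-- exponential series e_j: from e_j(x + t) ≤ e_j(x) / (1 − t) with t = D/n one gets
-- e_j(kD) ≤ (n / (n − D))^(kn).

open import Defs
open import Data.Nat using (ℕ; zero; suc; _+_; _*_; _^_; _∸_; _≤_; _<_; _≤?_; z≤n; s≤s; NonZero; >-nonZero)
open import Data.Nat.Properties
open import Data.Nat.Tactic.RingSolver using (solve-∀)
open import Data.Fin as Fin using (Fin) renaming (_≟_ to _≟ᶠ_)
open import Data.Fin.Properties using (injective⇒≤)
open import Data.Product using (Σ-syntax; _×_; _,_; proj₁; proj₂; uncurry)
import Data.Product.Properties as Product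
open import Data.List as List
  using (List; []; _∷_; [_]; length; map; _++_; filter; allFin; cartesianProductWith; cartesianProduct)
open import Data.List.Properties using (length-map; length-++; length-tabulate)
open import Data.List.Membership.Propositional using (_∈_)
open import Data.List.Membership.Propositional.Properties
  using (∈-map⁺; ∈-map⁻; ∈-filter⁺; ∈-filter⁻; ∈-allFin; ∈-lookup; ∈-cartesianProductWith⁺; ∈-cartesianProduct⁺)
open import Data.List.Relation.Unary.Any using (here; there; index)
open import Data.List.Relation.Unary.Any.Properties using (lookup-index)
open import Data.List.Relation.Unary.All as All using (All; []; _∷_)
open import Data.List.Relation.Unary.All.Properties
  using (All¬⇒¬Any; ¬Any⇒All¬; all-filter; filter⁺) renaming (++⁺ to All-++⁺; map⁺ to All-map⁺)
open import Data.List.Relation.Unary.AllPairs using ([]; _∷_)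
open import Data.List.Relation.Unary.Unique.Propositional using (Unique)
open import Data.List.Relation.Unary.Unique.Propositional.Properties
  using (allFin⁺) renaming (++⁺ to Unique-++⁺; map⁺ to Unique-map⁺; filter⁺ to Unique-filter⁺)
open import Data.List.Relation.Binary.Subset.Propositional using (_⊆_)
open import Data.Vec as Vec using (Vec)
open import Function using (_∘_; id)
open import Relation.Binary.Definitions using (DecidableEquality)
open import Relation.Binary.PropositionalEquality using (_≡_; _≢_; refl; sym; trans; cong; cong₂; module ≡-Reasoning)
open import Relation.Nullary using (¬_; yes; no; contradiction)
open import Relation.Unary using (Decidable)
open import Relation.Unary.Properties using (∁?)

-- Truncated exponential series

-- expPartialOver q a j = j! q^j Σ_{i≤j} (a/q)^i / i!, so that a = c q gives back expPartialScaled c j.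
expPartialOver : ℕ → ℕ → ℕ → ℕ
expPartialOver q a zero    = 1
expPartialOver q a (suc j) = suc j * q * expPartialOver q a j + a ^ suc j

^-distribʳ-* : ∀ m n o → (m * n) ^ o ≡ m ^ o * n ^ o
^-distribʳ-* m n zero    = refl
^-distribʳ-* m n (suc o) = begin
  m * n * (m * n) ^ o       ≡⟨ cong (m * n *_) (^-distribʳ-* m n o) ⟩
  m * n * (m ^ o * n ^ o)   ≡⟨ lemma m n (m ^ o) (n ^ o) ⟩
  m * m ^ o * (n * n ^ o)   ∎
  where
  open ≡-Reasoning
  lemma : ∀ a b c d → a * b * (c * d) ≡ a * c * (b * d)
  lemma = solve-∀

expPartialOver-homogeneous : ∀ q c j → expPartialOver q (c * q) j ≡ q ^ j * expPartialScaled c j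
expPartialOver-homogeneous q c zero    = refl
expPartialOver-homogeneous q c (suc j) = begin
  suc j * q * expPartialOver q (c * q) j + (c * q) ^ suc j
    ≡⟨ cong₂ (λ a b → suc j * q * a + b) (expPartialOver-homogeneous q c j) (^-distribʳ-* c q (suc j)) ⟩
  suc j * q * (q ^ j * expPartialScaled c j) + c ^ suc j * (q * q ^ j)
    ≡⟨ lemma (suc j) q (q ^ j) (expPartialScaled c j) (c ^ suc j) ⟩
  q * q ^ j * (suc j * expPartialScaled c j + c ^ suc j)
    ∎
  where
  open ≡-Reasoning
  lemma : ∀ a q Q T C → a * q * (Q * T) + C * (q * Q) ≡ q * Q * (a * T + C)
  lemma = solve-∀

expPartialScaled-zero : ∀ j → expPartialScaled 0 j ≡ factorial j
expPartialScaled-zero zero    = refl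
expPartialScaled-zero (suc j) = trans (+-identityʳ _) (cong (suc j *_) (expPartialScaled-zero j))

expPartialOver-zero : ∀ q j → expPartialOver q 0 j ≡ q ^ j * factorial j
expPartialOver-zero q j = trans (expPartialOver-homogeneous q 0 j) (cong (q ^ j *_) (expPartialScaled-zero j))

^-suc-mean-value : ∀ z p i → (p + z) ^ suc i ≤ z ^ suc i + suc i * p * (p + z) ^ i
^-suc-mean-value z p zero    = ≤-reflexive (lemma z p)
  where
  lemma : ∀ z p → (p + z) * 1 ≡ z * 1 + 1 * p * 1
  lemma = solve-∀
^-suc-mean-value z p (suc i) = begin
  (p + z) * (p + z) ^ suc i
    ≤⟨ *-monoʳ-≤ (p + z) (^-suc-mean-value z p i) ⟩
  (p + z) * (z ^ suc i + suc i * p * (p + z) ^ i)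
    ≡⟨ expand z p (z ^ suc i) ((p + z) ^ i) (suc i) ⟩
  z * z ^ suc i + (p * z ^ suc i + suc i * p * (p + z) ^ suc i)
    ≤⟨ +-monoʳ-≤ (z * z ^ suc i) (+-monoˡ-≤ _ (*-monoʳ-≤ p (^-monoˡ-≤ (suc i) (m≤n+m z p)))) ⟩
  z * z ^ suc i + (p * (p + z) ^ suc i + suc i * p * (p + z) ^ suc i)
    ≡⟨ cong (z * z ^ suc i +_) (collect p ((p + z) ^ suc i) (suc i)) ⟩
  z * z ^ suc i + suc (suc i) * p * (p + z) ^ suc i
    ∎
  where
  open ≤-Reasoning
  expand : ∀ z p A B c → (p + z) * (A + c * p * B) ≡ z * A + (p * A + c * p * ((p + z) * B))
  expand = solve-∀
  collect : ∀ p X c → p * X + c * p * X ≡ (1 + c) * p * X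
  collect = solve-∀

-- The derivative of Σ_{i≤j+1} x^i/i! is Σ_{i≤j} x^i/i!; this is the resulting mean value inequality.
expPartialOver-mean-value : ∀ q z p j →
  expPartialOver q (p + z) (suc j) ≤ expPartialOver q z (suc j) + suc j * p * expPartialOver q (p + z) j
expPartialOver-mean-value q z p zero = ≤-reflexive (lemma q z p)
  where
  lemma : ∀ q z p → 1 * q * 1 + (p + z) * 1 ≡ 1 * q * 1 + z * 1 + 1 * p * 1
  lemma = solve-∀
expPartialOver-mean-value q z p (suc j) = begin
  suc (suc j) * q * T (p + z) (suc j) + (p + z) ^ suc (suc j)
    ≤⟨ +-mono-≤ (*-monoʳ-≤ (suc (suc j) * q) (expPartialOver-mean-value q z p j)) (^-suc-mean-value z p (suc j)) ⟩
  suc (suc j) * q * (T z (suc j) + suc j * p * T (p + z) j) + (z ^ suc (suc j) + suc (suc j) * p * (p + z) ^ suc j)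
    ≡⟨ regroup (suc j) q (T z (suc j)) (T (p + z) j) p (z ^ suc (suc j)) ((p + z) ^ suc j) ⟩
  (suc (suc j) * q * T z (suc j) + z ^ suc (suc j)) + suc (suc j) * p * (suc j * q * T (p + z) j + (p + z) ^ suc j)
    ∎
  where
  open ≤-Reasoning
  T : ℕ → ℕ → ℕ
  T = expPartialOver q
  regroup : ∀ c q A B p Z Y → (1 + c) * q * (A + c * p * B) + (Z + (1 + c) * p * Y)
                             ≡ ((1 + c) * q * A + Z) + (1 + c) * p * (c * q * B + Y)
  regroup = solve-∀

-- With x = z/q, t = p/q and r = q − p, this reads e_j(x + t) ≤ e_j(x) / (1 − t).
expPartialOver-step : ∀ p r z j → r * expPartialOver (p + r) (p + z) j ≤ (p + r) * expPartialOver (p + r) z j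
expPartialOver-step p r z zero    = *-monoˡ-≤ 1 (m≤n+m r p)
expPartialOver-step p r z (suc j) = +-cancelˡ-≤ (p * Y) _ _ (begin
  p * Y + r * Y
    ≡⟨ *-distribʳ-+ Y p r ⟨
  q * Y
    ≤⟨ *-monoʳ-≤ q (expPartialOver-mean-value q z p j) ⟩
  q * (Z + suc j * p * Y′)
    ≡⟨ regroup q Z (suc j) p Y′ ⟩
  p * (suc j * q * Y′) + q * Z
    ≤⟨ +-monoˡ-≤ (q * Z) (*-monoʳ-≤ p (m≤m+n (suc j * q * Y′) ((p + z) ^ suc j))) ⟩
  p * Y + q * Z
    ∎)
  where
  open ≤-Reasoning
  q = p + r
  Y = expPartialOver q (p + z) (suc j)
  Y′ = expPartialOver q (p + z) j
  Z = expPartialOver q z (suc j)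
  regroup : ∀ q Z c p Y′ → q * (Z + c * p * Y′) ≡ p * (c * q * Y′) + q * Z
  regroup = solve-∀

expPartialOver-geometric : ∀ p r M j →
  r ^ M * expPartialOver (p + r) (M * p) j ≤ (p + r) ^ M * expPartialOver (p + r) 0 j
expPartialOver-geometric p r zero    j = ≤-refl
expPartialOver-geometric p r (suc M) j = begin
  r * r ^ M * T (p + M * p)      ≡⟨ assoc-comm r (r ^ M) (T (p + M * p)) ⟩
  r ^ M * (r * T (p + M * p))    ≤⟨ *-monoʳ-≤ (r ^ M) (expPartialOver-step p r (M * p) j) ⟩
  r ^ M * (q * T (M * p))        ≡⟨ left-comm (r ^ M) q (T (M * p)) ⟩
  q * (r ^ M * T (M * p))        ≤⟨ *-monoʳ-≤ q (expPartialOver-geometric p r M j) ⟩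
  q * (q ^ M * T 0)              ≡⟨ *-assoc q (q ^ M) (T 0) ⟨
  q * q ^ M * T 0                ∎
  where
  open ≤-Reasoning
  q = p + r
  T : ℕ → ℕ
  T a = expPartialOver q a j
  assoc-comm : ∀ a b c → a * b * c ≡ b * (a * c)
  assoc-comm = solve-∀
  left-comm : ∀ a b c → a * (b * c) ≡ b * (a * c)
  left-comm = solve-∀

factorial>0 : ∀ j → 0 < factorial j
factorial>0 zero    = s≤s z≤n
factorial>0 (suc j) = *-mono-≤ {1} {suc j} (s≤s z≤n) (factorial>0 j)

^-cancelʳ-≤ : ∀ {a b} q .{{_ : NonZero q}} → a ^ q ≤ b ^ q → a ≤ b
^-cancelʳ-≤ {a} {b} q a^q≤b^q with a ≤? b
... | yes a≤b = a≤b
... | no  a≰b = contradiction a^q≤b^q (<⇒≱ (^-monoˡ-< q (≰⇒> a≰b)))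

-- e^(kp) ≥ p^(2q) and e^(kp) ≤ (q/r)^(kq) give p^(2q) r^(kq) ≤ q^(kq); then take q-th roots.
atLeastBound⇒r^k*p*p≤[p+r]^k : ∀ p r k .{{_ : NonZero (p + r)}} →
  AtLeastBound (p + r) p k → r ^ k * (p * p) ≤ (p + r) ^ k
atLeastBound⇒r^k*p*p≤[p+r]^k p r k (j , p^[2q]*j!≤e) = ^-cancelʳ-≤ q (begin
  (r ^ k * (p * p)) ^ q          ≡⟨ ^-distribʳ-* (r ^ k) (p * p) q ⟩
  (r ^ k) ^ q * (p * p) ^ q      ≡⟨ cong₂ _*_ (^-*-assoc r k q) [p*p]^q≡p^[2*q] ⟩
  r ^ M * p ^ (2 * q)            ≤⟨ *-cancelʳ-≤ _ _ (q ^ j * factorial j) {{nonZero-q^j*j!}} scaled ⟩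
  q ^ M                          ≡⟨ ^-*-assoc q k q ⟨
  (q ^ k) ^ q                    ∎)
  where
  open ≤-Reasoning
  q = p + r
  M = k * q
  nonZero-q^j*j! : NonZero (q ^ j * factorial j)
  nonZero-q^j*j! = >-nonZero (*-mono-≤ {1} (m^n>0 q j) (factorial>0 j))
  [p*p]^q≡p^[2*q] : (p * p) ^ q ≡ p ^ (2 * q)
  [p*p]^q≡p^[2*q] = begin-equality
    (p * p) ^ q        ≡⟨ ^-distribʳ-* p p q ⟩
    p ^ q * p ^ q      ≡⟨ ^-distribˡ-+-* p q q ⟨
    p ^ (q + q)        ≡⟨ cong (λ m → p ^ (q + m)) (+-identityʳ q) ⟨
    p ^ (2 * q)        ∎
  scaled : r ^ M * p ^ (2 * q) * (q ^ j * factorial j) ≤ q ^ M * (q ^ j * factorial j)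
  scaled = begin
    r ^ M * p ^ (2 * q) * (q ^ j * factorial j)
      ≡⟨ regroup (r ^ M) (p ^ (2 * q)) (q ^ j) (factorial j) ⟩
    r ^ M * (q ^ j * (p ^ (2 * q) * factorial j))
      ≤⟨ *-monoʳ-≤ (r ^ M) (*-monoʳ-≤ (q ^ j) p^[2q]*j!≤e) ⟩
    r ^ M * (q ^ j * expPartialScaled (k * p) j)
      ≡⟨ cong (r ^ M *_) (expPartialOver-homogeneous q (k * p) j) ⟨
    r ^ M * expPartialOver q (k * p * q) j
      ≡⟨ cong (λ a → r ^ M * expPartialOver q a j) (swap k p q) ⟩
    r ^ M * expPartialOver q (M * p) j
      ≤⟨ expPartialOver-geometric p r M j ⟩
    q ^ M * expPartialOver q 0 j
      ≡⟨ cong (q ^ M *_) (expPartialOver-zero q j) ⟩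
    q ^ M * (q ^ j * factorial j)
      ∎
    where
    regroup : ∀ a b c d → a * b * (c * d) ≡ a * (c * (b * d))
    regroup = solve-∀
    swap : ∀ k p q → k * p * q ≡ k * q * p
    swap = solve-∀

ExpGe-zero⇒≤1 : ∀ {N} → ExpGe 0 N → N ≤ 1
ExpGe-zero⇒≤1 {N} (j , N*j!≤e) = *-cancelʳ-≤ N 1 (factorial j) {{>-nonZero (factorial>0 j)}}
  (≤-trans N*j!≤e (≤-reflexive (trans (expPartialScaled-zero j) (sym (*-identityˡ _)))))

-- For D > n, n ∸ D truncates to 0; the bound still needs k ≠ 0, which holds as e^0 < D^(2n).
atLeastBound⇒[n∸D]^k*D*D≤n^k : ∀ n D k → 1 ≤ n → 2 ≤ D → AtLeastBound n D k →
  (n ∸ D) ^ k * (D * D) ≤ n ^ k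
atLeastBound⇒[n∸D]^k*D*D≤n^k n D k 1≤n 2≤D bound with D ≤? n
... | yes D≤n with m≤n⇒∃[o]m+o≡n D≤n
...   | r , refl rewrite m+n∸m≡n D r =
  atLeastBound⇒r^k*p*p≤[p+r]^k D r k {{>-nonZero 1≤n}} bound
atLeastBound⇒[n∸D]^k*D*D≤n^k n D zero 1≤n 2≤D bound | no _ =
  contradiction (ExpGe-zero⇒≤1 bound) (<⇒≱ (<-≤-trans 2≤D D≤D^[2*n]))
  where
  D≤D^[2*n] : D ≤ D ^ (2 * n)
  D≤D^[2*n] = ≤-trans (≤-reflexive (sym (^-identityʳ D)))
                (^-monoʳ-≤ D {{>-nonZero (<-trans (s≤s z≤n) 2≤D)}} (≤-trans 1≤n (m≤m+n n _)))
atLeastBound⇒[n∸D]^k*D*D≤n^k n D (suc k) 1≤n 2≤D bound | no D≰n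
  rewrite m≤n⇒m∸n≡0 (≰⇒≥ D≰n) = z≤n

-- Counting with lists

module _ {A : Set} where

  Unique⇒lookup-injective : ∀ {xs : List A} → Unique xs → ∀ {i j} → List.lookup xs i ≡ List.lookup xs j → i ≡ j
  Unique⇒lookup-injective (_ ∷ _)    {Fin.zero}  {Fin.zero}  _  = refl
  Unique⇒lookup-injective (x∉xs ∷ _) {Fin.zero}  {Fin.suc j} eq = contradiction eq (All.lookup x∉xs (∈-lookup j))
  Unique⇒lookup-injective (x∉xs ∷ _) {Fin.suc i} {Fin.zero}  eq = contradiction (sym eq) (All.lookup x∉xs (∈-lookup i))
  Unique⇒lookup-injective (_ ∷ uxs)  {Fin.suc i} {Fin.suc j} eq = cong Fin.suc (Unique⇒lookup-injective uxs eq)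

  Unique⇒⊆⇒length≤ : ∀ {xs ys : List A} → Unique xs → xs ⊆ ys → length xs ≤ length ys
  Unique⇒⊆⇒length≤ {xs} {ys} uxs xs⊆ys = injective⇒≤ {f = position} position-injective
    where
    position : Fin (length xs) → Fin (length ys)
    position i = index (xs⊆ys (∈-lookup i))
    position-injective : ∀ {i j} → position i ≡ position j → i ≡ j
    position-injective {i} {j} eq = Unique⇒lookup-injective uxs (begin
      List.lookup xs i              ≡⟨ lookup-index (xs⊆ys (∈-lookup i)) ⟩
      List.lookup ys (position i)   ≡⟨ cong (List.lookup ys) eq ⟩
      List.lookup ys (position j)   ≡⟨ lookup-index (xs⊆ys (∈-lookup j)) ⟨
      List.lookup xs j              ∎)
      where open ≡-Reasoning

  length-filter-∁ : ∀ {P : A → Set} (P? : Decidable P) xs →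
    length (filter P? xs) + length (filter (∁? P?) xs) ≡ length xs
  length-filter-∁ P? []       = refl
  length-filter-∁ P? (x ∷ xs) with P? x
  ... | yes _ = cong suc (length-filter-∁ P? xs)
  ... | no  _ = trans (+-suc _ _) (cong suc (length-filter-∁ P? xs))

module _ {A B C : Set} (f : A → B → C) where

  length-cartesianProductWith : ∀ xs ys → length (cartesianProductWith f xs ys) ≡ length xs * length ys
  length-cartesianProductWith []       ys = refl
  length-cartesianProductWith (x ∷ xs) ys = begin
    length (map (f x) ys ++ cartesianProductWith f xs ys)
      ≡⟨ length-++ (map (f x) ys) ⟩
    length (map (f x) ys) + length (cartesianProductWith f xs ys)
      ≡⟨ cong₂ _+_ (length-map (f x) ys) (length-cartesianProductWith xs ys) ⟩
    length ys + length xs * length ys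
      ∎
    where open ≡-Reasoning

module _ {A : Set} where

  vectorsOver : List A → (k : ℕ) → List (Vec A k)
  vectorsOver xs zero    = [ Vec.[] ]
  vectorsOver xs (suc k) = cartesianProductWith Vec._∷_ xs (vectorsOver xs k)

  length-vectorsOver : ∀ xs k → length (vectorsOver xs k) ≡ length xs ^ k
  length-vectorsOver xs zero    = refl
  length-vectorsOver xs (suc k) =
    trans (length-cartesianProductWith Vec._∷_ xs (vectorsOver xs k)) (cong (length xs *_) (length-vectorsOver xs k))

  ∈-vectorsOver : ∀ xs {k} (v : Vec A k) → (∀ i → Vec.lookup v i ∈ xs) → v ∈ vectorsOver xs k
  ∈-vectorsOver xs Vec.[]       _    = here refl
  ∈-vectorsOver xs (x Vec.∷ v) v⊆xs =
    ∈-cartesianProductWith⁺ Vec._∷_ (v⊆xs Fin.zero) (∈-vectorsOver xs v (v⊆xs ∘ Fin.suc))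

module _ {A B : Set} (P : A → B → Set) (c w : ℕ) where

  ManyPartners : A → Set
  ManyPartners a = Σ[ bs ∈ List B ] Unique bs × All (P a) bs × c ≤ length bs * w

  manyPartners⇒manyPairs : ∀ {xs} → Unique xs → All ManyPartners xs →
    Σ[ ps ∈ List (A × B) ] Unique ps × All (uncurry P) ps × length xs * c ≤ length ps * w
  manyPartners⇒manyPairs uxs partners = let ps , ups , Pps , _ , bound = pairs uxs partners in ps , ups , Pps , bound
    where
    pairs : ∀ {xs} → Unique xs → All ManyPartners xs →
      Σ[ ps ∈ List (A × B) ] Unique ps × All (uncurry P) ps × All ((_∈ xs) ∘ proj₁) ps × length xs * c ≤ length ps * w
    pairs {[]}     _            _  = [] , [] , [] , [] , z≤n
    pairs {a ∷ xs} (a∉xs ∷ uxs) ((bs , ubs , Pbs , c≤bs*w) ∷ partners)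
      with ps , ups , Pps , ps⊆xs , c*xs≤ps*w ← pairs uxs partners =
      map (a ,_) bs ++ ps ,
      Unique-++⁺ (Unique-map⁺ (λ { refl → refl }) ubs) ups disjoint ,
      All-++⁺ (All-map⁺ Pbs) Pps ,
      All-++⁺ (All-map⁺ (All.tabulate (λ _ → here refl))) (All.map there ps⊆xs) ,
      (begin
        c + length xs * c                          ≤⟨ +-mono-≤ c≤bs*w c*xs≤ps*w ⟩
        length bs * w + length ps * w              ≡⟨ *-distribʳ-+ w (length bs) (length ps) ⟨
        (length bs + length ps) * w                ≡⟨ cong (λ m → (m + length ps) * w) (length-map (a ,_) bs) ⟨
        (length (map (a ,_) bs) + length ps) * w   ≡⟨ cong (_* w) (length-++ (map (a ,_) bs)) ⟨
        length (map (a ,_) bs ++ ps) * w           ∎)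
      where
      open ≤-Reasoning
      disjoint : ∀ {t} → ¬ (t ∈ map (a ,_) bs × t ∈ ps)
      disjoint (t∈abs , t∈ps) with _ , _ , refl ← ∈-map⁻ (a ,_) t∈abs = All¬⇒¬Any a∉xs (All.lookup ps⊆xs t∈ps)

module _ {X K : Set} (_≟_ : DecidableEquality K) (key : X → K) (Q : X → Set) (C : ℕ)
         (group-≤ : ∀ {t} → Q t → Σ[ St ∈ List X ] length St ≤ C × (∀ {t′} → Q t′ → key t′ ≡ key t → t′ ∈ St))
         where

  sameKey-length≤ : ∀ {κ ys} → Unique ys → All Q ys → All ((_≡ κ) ∘ key) ys → length ys ≤ C
  sameKey-length≤ {ys = []}     _   _          _           = z≤n
  sameKey-length≤ {ys = y ∷ ys} uys Qys@(Qy ∷ _) keys@(key≡κ ∷ _)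
    with St , St≤C , St⊇ ← group-≤ Qy =
    ≤-trans (Unique⇒⊆⇒length≤ uys (λ m → St⊇ (All.lookup Qys m) (trans (All.lookup keys m) (sym key≡κ)))) St≤C

  length≤keys*C : ∀ (ks : List K) {T} → Unique T → All Q T → All ((_∈ ks) ∘ key) T → length T ≤ length ks * C
  length≤keys*C []       {[]}    _  _  _        = z≤n
  length≤keys*C []       {_ ∷ _} _  _  (() ∷ _)
  length≤keys*C (κ ∷ ks) {T}     uT QT keysT    = begin
    length T
      ≡⟨ length-filter-∁ has-κ? T ⟨
    length (filter has-κ? T) + length (filter (∁? has-κ?) T)
      ≤⟨ +-mono-≤ (sameKey-length≤ (Unique-filter⁺ has-κ? uT) (filter⁺ has-κ? QT) (all-filter has-κ? T))
                  (length≤keys*C ks (Unique-filter⁺ (∁? has-κ?) uT) (filter⁺ (∁? has-κ?) QT) other-keys) ⟩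
    C + length ks * C
      ∎
    where
    open ≤-Reasoning
    has-κ? : Decidable ((_≡ κ) ∘ key)
    has-κ? t = key t ≟ κ
    other-keys : All ((_∈ ks) ∘ key) (filter (∁? has-κ?) T)
    other-keys = All.zipWith drop-κ (filter⁺ (∁? has-κ?) keysT , all-filter (∁? has-κ?) T)
      where
      drop-κ : ∀ {t} → key t ∈ κ ∷ ks × key t ≢ κ → key t ∈ ks
      drop-κ (here key≡κ , key≢κ) = contradiction key≡κ key≢κ
      drop-κ (there m    , _)     = m

length-allFin : ∀ n → length (allFin n) ≡ n
length-allFin n = length-tabulate id

-- Shortest paths

module _ {n : ℕ} (G : Graph n) where

  open import Data.List.Membership.DecPropositional (_≟ᶠ_ {n}) using (_∉_; _∉?_)

  nodes : ∀ {u v ℓ} → Walk G u v ℓ → List (Fin n)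
  nodes (here {u})     = [ u ]
  nodes (step {u} _ p) = u ∷ nodes p

  length-nodes : ∀ {u v ℓ} (p : Walk G u v ℓ) → length (nodes p) ≡ suc ℓ
  length-nodes here       = refl
  length-nodes (step _ p) = cong suc (length-nodes p)

  ∈-nodes⇒OnWalk : ∀ {x u v ℓ} (p : Walk G u v ℓ) → x ∈ nodes p → OnWalk G x p
  ∈-nodes⇒OnWalk here       (here refl) = on-here
  ∈-nodes⇒OnWalk (step a p) (here refl) = on-start a p
  ∈-nodes⇒OnWalk (step a p) (there x∈p) = on-later a (∈-nodes⇒OnWalk p x∈p)

  ∈-nodes⇒suffix : ∀ {x u v ℓ} (p : Walk G u v ℓ) → x ∈ nodes p → Σ[ ℓ′ ∈ ℕ ] ℓ′ ≤ ℓ × Walk G x v ℓ′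
  ∈-nodes⇒suffix here       (here refl) = 0 , z≤n , here
  ∈-nodes⇒suffix (step a p) (here refl) = _ , ≤-refl , step a p
  ∈-nodes⇒suffix (step a p) (there x∈p) =
    let ℓ′ , ℓ′≤ℓ , q = ∈-nodes⇒suffix p x∈p in ℓ′ , m≤n⇒m≤1+n ℓ′≤ℓ , q

  shortest⇒Unique-nodes : ∀ {u v d} (p : Walk G u v d) → (∀ ℓ → Walk G u v ℓ → d ≤ ℓ) → Unique (nodes p)
  shortest⇒Unique-nodes here       _        = [] ∷ []
  shortest⇒Unique-nodes (step a p) shortest =
    ¬Any⇒All¬ (nodes p) u∉p ∷ shortest⇒Unique-nodes p (λ ℓ q → ≤-pred (shortest (suc ℓ) (step a q)))
    where
    u∉p : _ ∉ nodes p
    u∉p u∈p = let ℓ′ , ℓ′≤ℓ , q = ∈-nodes⇒suffix p u∈p in <⇒≱ (s≤s ℓ′≤ℓ) (shortest ℓ′ q)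

  offPath : ∀ {u v ℓ} → Walk G u v ℓ → List (Fin n)
  offPath p = filter (_∉? nodes p) (allFin n)

  ∈-offPath : ∀ {x u v ℓ} (p : Walk G u v ℓ) → x ∉ nodes p → x ∈ offPath p
  ∈-offPath p x∉p = ∈-filter⁺ (_∉? nodes p) (∈-allFin _) x∉p

  length-offPath : ∀ {u v ℓ} (p : Walk G u v ℓ) → Unique (nodes p) → length (offPath p) + suc ℓ ≤ n
  length-offPath {ℓ = ℓ} p unique = begin
    length (offPath p) + suc ℓ                ≡⟨ cong (length (offPath p) +_) (length-nodes p) ⟨
    length (offPath p) + length (nodes p)     ≡⟨ length-++ (offPath p) ⟨
    length (offPath p ++ nodes p)             ≤⟨ Unique⇒⊆⇒length≤ unique-offPath++nodes (λ {x} _ → ∈-allFin x) ⟩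
    length (allFin n)                         ≡⟨ length-allFin n ⟩
    n                                         ∎
    where
    open ≤-Reasoning
    disjoint : ∀ {x} → ¬ (x ∈ offPath p × x ∈ nodes p)
    disjoint (x∈off , x∈p) = proj₂ (∈-filter⁻ (_∉? nodes p) {xs = allFin n} x∈off) x∈p
    unique-offPath++nodes : Unique (offPath p ++ nodes p)
    unique-offPath++nodes = Unique-++⁺ (Unique-filter⁺ (_∉? nodes p) (allFin⁺ n)) unique disjoint

-- Counting uncovered triples

module _ {n : ℕ} (G : Graph n) (D k : ℕ) where

  UncoveredFor : Vec (Fin n) k → Fin n × Fin n → Set
  UncoveredFor R (u , v) = Uncovered G D R u v

  UncoveredTriple : Vec (Fin n) k × (Fin n × Fin n) → Set
  UncoveredTriple = uncurry UncoveredFor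

  -- The samples for which v is uncovered for u all avoid one fixed shortest u–v path, of at least D + 1 nodes.
  uncovered-samples-≤ : ∀ {t} → UncoveredTriple t →
    Σ[ St ∈ List _ ] length St ≤ (n ∸ D) ^ k × (∀ {t′} → UncoveredTriple t′ → proj₂ t′ ≡ proj₂ t → t′ ∈ St)
  uncovered-samples-≤ {R , u , v} ((d , (p , shortest) , D≤d) , _) = St , length-St , St-covers
    where
    St = map (_, u , v) (vectorsOver (offPath G p) k)
    length-St : length St ≤ (n ∸ D) ^ k
    length-St = begin
      length St                               ≡⟨ length-map (_, u , v) (vectorsOver (offPath G p) k) ⟩
      length (vectorsOver (offPath G p) k)    ≡⟨ length-vectorsOver (offPath G p) k ⟩
      length (offPath G p) ^ k                ≤⟨ ^-monoˡ-≤ k (≤-trans offPath≤n∸[d+1] (∸-monoʳ-≤ n D≤d+1)) ⟩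
      (n ∸ D) ^ k                             ∎
      where
      open ≤-Reasoning
      offPath≤n∸[d+1] : length (offPath G p) ≤ n ∸ suc d
      offPath≤n∸[d+1] = m+n≤o⇒m≤o∸n _ (length-offPath G p (shortest⇒Unique-nodes G p shortest))
      D≤d+1 : D ≤ suc d
      D≤d+1 = ≤-trans D≤d (n≤1+n d)
    St-covers : ∀ {t′} → UncoveredTriple t′ → proj₂ t′ ≡ (u , v) → t′ ∈ St
    St-covers {R′ , _ , _} (_ , R′-avoids) refl = ∈-map⁺ (_, u , v) (∈-vectorsOver (offPath G p) R′ λ i →
      ∈-offPath G p λ Rᵢ∈p → R′-avoids i (d , (p , shortest) , p , ∈-nodes⇒OnWalk G p Rᵢ∈p))

  sick⇒manyPartners : ∀ {R : Vec (Fin n) k} {u} → Sick G D R u → ManyPartners (Uncovered G D R) n D u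
  sick⇒manyPartners (vs , uvs , uncovered , n<vs*D) = vs , uvs , uncovered , <⇒≤ n<vs*D

  manySick⇒manyPartners : ∀ {R : Vec (Fin n) k} → ManySick G D R → ManyPartners UncoveredFor (2 * n * n) (D * D) R
  manySick⇒manyPartners {R} (us , uus , sick , 2n≤us*D) =
    let ps , ups , uncovered , us*n≤ps*D = manyPartners⇒manyPairs (Uncovered G D R) n D uus (All.map (sick⇒manyPartners {R}) sick)
    in ps , ups , uncovered , (begin
      2 * n * n              ≤⟨ *-monoˡ-≤ n 2n≤us*D ⟩
      length us * D * n      ≡⟨ *-comm-middle (length us) D n ⟩
      length us * n * D      ≤⟨ *-monoˡ-≤ D us*n≤ps*D ⟩
      length ps * D * D      ≡⟨ *-assoc (length ps) D D ⟩
      length ps * (D * D)    ∎)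
    where
    open ≤-Reasoning
    *-comm-middle : ∀ a b c → a * b * c ≡ a * c * b
    *-comm-middle = solve-∀

  manySick⇒uncoveredTriples : ∀ {Rs} → Unique Rs → All (ManySick G D) Rs →
    Σ[ T ∈ List _ ] Unique T × All UncoveredTriple T × length Rs * (2 * n * n) ≤ length T * (D * D)
  manySick⇒uncoveredTriples uRs manySick =
    manyPartners⇒manyPairs UncoveredFor (2 * n * n) (D * D) uRs (All.map (λ {R} → manySick⇒manyPartners {R}) manySick)

  uncoveredTriples-length≤ : ∀ {T} → Unique T → All UncoveredTriple T → length T ≤ n * n * (n ∸ D) ^ k
  uncoveredTriples-length≤ {T} uT uncovered = begin
    length T
      ≤⟨ length≤keys*C (Product.≡-dec _≟ᶠ_ _≟ᶠ_) proj₂ UncoveredTriple ((n ∸ D) ^ k)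
           (λ {t} → uncovered-samples-≤ {t}) allPairs uT uncovered
           (All.tabulate λ {(_ , u , v)} _ → ∈-cartesianProduct⁺ (∈-allFin u) (∈-allFin v)) ⟩
    length allPairs * (n ∸ D) ^ k
      ≡⟨ cong (_* (n ∸ D) ^ k) (length-cartesianProductWith _,_ (allFin n) (allFin n)) ⟩
    length (allFin n) * length (allFin n) * (n ∸ D) ^ k
      ≡⟨ cong (λ m → m * m * (n ∸ D) ^ k) (length-allFin n) ⟩
    n * n * (n ∸ D) ^ k
      ∎
    where
    open ≤-Reasoning
    allPairs = cartesianProduct (allFin n) (allFin n)

lemma3 : ∀ (n : ℕ) (G : Graph n) (D k : ℕ) → 1 ≤ n → 2 ≤ D → IsSampleSize n D k →
           ProbAtMostHalf n k (λ R → ManySick G D R)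
lemma3 n G D k 1≤n 2≤D (atLeastBound , _) Rs uRs manySick
  with T , uT , uncovered , Rs*2n²≤T*D² ← manySick⇒uncoveredTriples G D k uRs manySick =
  *-cancelʳ-≤ (2 * length Rs) (n ^ k) (n * n) {{>-nonZero (*-mono-≤ 1≤n 1≤n)}} (begin
    2 * length Rs * (n * n)            ≡⟨ regroup (length Rs) n ⟩
    length Rs * (2 * n * n)            ≤⟨ Rs*2n²≤T*D² ⟩
    length T * (D * D)                 ≤⟨ *-monoˡ-≤ (D * D) (uncoveredTriples-length≤ G D k uT uncovered) ⟩
    n * n * (n ∸ D) ^ k * (D * D)      ≡⟨ *-assoc (n * n) _ _ ⟩
    n * n * ((n ∸ D) ^ k * (D * D))    ≤⟨ *-monoʳ-≤ (n * n) (atLeastBound⇒[n∸D]^k*D*D≤n^k n D k 1≤n 2≤D atLeastBound) ⟩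
    n * n * n ^ k                      ≡⟨ *-comm (n * n) (n ^ k) ⟩
    n ^ k * (n * n)                    ∎)
  where
  open ≤-Reasoning
  regroup : ∀ a n → 2 * a * (n * n) ≡ a * (2 * n * n)
  regroup = solve-∀
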